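{- Let $G$ be a leaf power and let $T$ be an unweighted leaf root of $G$. Then every refinement $T'$ of $T$ is also an unweighted leaf root of $G$.
   Context: For a tree $T$ with edge weighting $f$, $d_f(x,y)$ denotes the sum of the weights of the edges on the unique $x$–$y$ path of $T$. A weighted tree $(T,f)$ with $f:E(T)\to\mathbb{N}^+$ and leaf set $V(G)$ is a leaf root of $G$ if there is an integer $k$ such that for all distinct $u,v\in V(G)$, $uv\in E(G)$ iff $d_f(u,v)\le k$. An unweighted tree $T$ is an unweighted leaf root of $G$ if some weighting $f:E(T)\to\mathbb{N}^+$ makes $(T,f)$ a leaf root of $G$. $G$ is a leaf power if it has a leaf root. A tree $T'$ is a refinement of a tree $T$ if $T$ can be obtained from $T'$ by contracting edges. -}

module Defs where

open import Data.Nat using (ℕ; zero; suc; _+_; _≤_)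
open import Data.Integer using (ℤ; +_) renaming (_≤_ to _≤ℤ_)
open import Data.Fin using (Fin)
open import Data.Bool using (Bool; true; false; T; if_then_else_)
open import Data.List using (List; []; _∷_; map; allFin; length)
open import Data.Nat.ListAction using (sum)
open import Data.List.Relation.Unary.Unique.Propositional using (Unique)
open import Data.Product using (Σ; ∃; _×_; _,_)
open import Relation.Binary.PropositionalEquality using (_≡_; _≢_)
open import Relation.Nullary using (¬_)

record Graph (n : ℕ) : Set where
  field
    E      : Fin n → Fin n → Bool
    sym    : ∀ x y → E x y ≡ E y x
    irrefl : ∀ x → E x x ≡ false
open Graph public

Adj : ∀ {n} → Graph n → Fin n → Fin n → Set
Adj G x y = T (E G x y)

data Walk {n} (G : Graph n) : Fin n → Fin n → Set where
  here : ∀ {x} → Walk G x x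
  step : ∀ {x y z} → Adj G x y → Walk G y z → Walk G x z

verts : ∀ {n} {G : Graph n} {x y} → Walk G x y → List (Fin n)
verts {x = x} here = x ∷ []
verts {x = x} (step _ w) = x ∷ verts w

len : ∀ {n} {G : Graph n} {x y} → Walk G x y → ℕ
len here = 0
len (step _ w) = suc (len w)

IsPath : ∀ {n} {G : Graph n} {x y} → Walk G x y → Set
IsPath w = Unique (verts w)

AllOn : ∀ {n} {G : Graph n} {x y} → (Fin n → Set) → Walk G x y → Set
AllOn {x = x} P here = P x
AllOn {x = x} P (step _ w) = P x × AllOn P w

Connected : ∀ {n} → Graph n → Set
Connected G = ∀ x y → Walk G x y

Acyclic : ∀ {n} → Graph n → Set
Acyclic G = ∀ x y (p : Walk G x y) → IsPath p → 2 ≤ len p → ¬ Adj G y x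

record Tree (m : ℕ) : Set where
  field
    graph     : Graph m
    nonempty  : 1 ≤ m
    connected : Connected graph
    acyclic   : Acyclic graph
open Tree public

degree : ∀ {n} → Graph n → Fin n → ℕ
degree {n} G x = sum (map (λ y → if E G x y then 1 else 0) (allFin n))

-- leaf: vertex of degree at most 1 (degree exactly 1 when the tree has
-- at least two vertices; the single vertex of a one-vertex tree is a leaf)
IsLeaf : ∀ {m} → Tree m → Fin m → Set
IsLeaf T x = degree (graph T) x ≤ 1

-- ℓ identifies V(G) = Fin n with the leaf set of the tree (a bijection
-- from Fin n onto the leaves)
LeafLabelling : ∀ {m} (n : ℕ) → Tree m → (Fin n → Fin m) → Set
LeafLabelling n T ℓ =
  (∀ u v → ℓ u ≡ ℓ v → u ≡ v) ×
  (∀ u → IsLeaf T (ℓ u)) ×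
  (∀ x → IsLeaf T x → ∃ λ u → ℓ u ≡ x)

weight : ∀ {n} {G : Graph n} {x y} → (Fin n → Fin n → ℕ) → Walk G x y → ℕ
weight f here = 0
weight f (step {x} {y} _ w) = f x y + weight f w

-- edge weighting f : E(T) → ℕ⁺, represented as a symmetric function on
-- pairs of vertices whose values on edges are positive
EdgeWeighting : ∀ {m} → Tree m → (Fin m → Fin m → ℕ) → Set
EdgeWeighting T f =
  (∀ x y → f x y ≡ f y x) × (∀ x y → Adj (graph T) x y → 1 ≤ f x y)

-- d_f(x,y) = d : the weight of the (unique) x–y path in T is d
Dist : ∀ {m} → Tree m → (Fin m → Fin m → ℕ) → Fin m → Fin m → ℕ → Set
Dist T f x y d = Σ (Walk (graph T) x y) λ p → IsPath p × weight f p ≡ d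

IsLeafRootWith : ∀ {n m} → Graph n → (T : Tree m) → (Fin n → Fin m) →
                 (Fin m → Fin m → ℕ) → ℤ → Set
IsLeafRootWith {n} G T ℓ f k =
  LeafLabelling n T ℓ × EdgeWeighting T f ×
  (∀ u v → u ≢ v →
     (Adj G u v → ∃ λ d → Dist T f (ℓ u) (ℓ v) d × (+ d) ≤ℤ k) ×
     ((∃ λ d → Dist T f (ℓ u) (ℓ v) d × (+ d) ≤ℤ k) → Adj G u v))

IsLeafRoot : ∀ {n m} → Graph n → (T : Tree m) → (Fin n → Fin m) →
             (Fin m → Fin m → ℕ) → Set
IsLeafRoot G T ℓ f = ∃ λ k → IsLeafRootWith G T ℓ f k

UnweightedLeafRoot : ∀ {n m} → Graph n → (T : Tree m) → (Fin n → Fin m) → Set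
UnweightedLeafRoot G T ℓ = ∃ λ f → IsLeafRoot G T ℓ f

LeafPower : ∀ {n} → Graph n → Set
LeafPower {n} G = Σ ℕ λ m → Σ (Tree m) λ T → Σ (Fin n → Fin m) λ ℓ →
  Σ (Fin m → Fin m → ℕ) λ f → IsLeafRoot G T ℓ f

-- c : V(T') → V(T) realises T as obtained from T' by contracting edges:
-- c is surjective, every fibre of c induces a connected subgraph of T'
-- (the contracted edges are those inside fibres), and two distinct
-- vertices of T are adjacent iff some edge of T' joins their fibres.
Contraction : ∀ {m m'} → Tree m' → Tree m → (Fin m' → Fin m) → Set
Contraction T' T c =
  (∀ a → ∃ λ x → c x ≡ a) ×
  (∀ x y → c x ≡ c y →
     Σ (Walk (graph T') x y) λ w → AllOn (λ z → c z ≡ c x) w) ×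
  (∀ a b → a ≢ b →
     (Adj (graph T) a b →
        ∃ λ x → ∃ λ y → c x ≡ a × c y ≡ b × Adj (graph T') x y) ×
     ((∃ λ x → ∃ λ y → c x ≡ a × c y ≡ b × Adj (graph T') x y) →
        Adj (graph T) a b))

Refinement : ∀ {n m m'} → (T : Tree m) → (Fin n → Fin m) →
             (T' : Tree m') → (Fin n → Fin m') → Set
Refinement {n} T ℓ T' ℓ' =
  LeafLabelling n T' ℓ' ×
  (Σ (_ → _) λ c → Contraction T' T c × (∀ u → c (ℓ' u) ≡ ℓ u))

module Submission where

-- Let (T, f) be a leaf root of G with threshold k, and let c : V(T') → V(T)
-- contract the refinement T' onto T, where T' has N = M + 1 vertices.
-- Weight an edge xy of T' by
--     f'(x,y) = N · f(c x, c y)   if c x ≠ c y   (an edge that survives in T),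
--     f'(x,y) = 1                  if c x = c y   (an edge contracted by c),
-- i.e. f' = N · h + ι with h the "projected weight" and ι the indicator of
-- contracted edges.  Walks of T' project to walks of T and, since the fibres
-- of c are connected, walks of T lift to walks of T'; both operations
-- preserve the h-weight.  A path of T' has at most M edges, so its ι-weight
-- is at most M.  Hence, with threshold N · k + M, a path of T' of weight
-- N · a + i (i ≤ M) is short iff a ≤ k, and (T', f') is a leaf root of G.

open import Defs hiding (sym)
open import Data.Nat using (ℕ; zero; suc; _+_; _*_; _≤_; _<_; z≤n; s≤s⁻¹)
open import Data.Nat.Properties hiding (_≟_)
open import Data.Nat.Solver using (module +-*-Solver)
open import Data.Integer using (ℤ; +_; -[1+_]; +≤+) renaming (_≤_ to _≤ℤ_)
open import Data.Fin using (Fin; zero; suc)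
open import Data.Fin.Properties using (_≟_; injective⇒≤)
open import Data.Bool using (T; if_then_else_)
open import Data.List using (List; length; lookup)
import Data.List.Relation.Unary.All as All
open import Data.List.Relation.Unary.All.Properties using (¬Any⇒All¬)
open import Data.List.Relation.Unary.Any using (here; there; any?)
open import Data.List.Relation.Unary.AllPairs using ([]; _∷_)
open import Data.List.Relation.Unary.Unique.Propositional using (Unique)
open import Data.List.Membership.Propositional using (_∈_)
open import Data.List.Membership.Propositional.Properties using (∈-lookup)
open import Data.Product using (Σ; ∃; _×_; _,_; proj₁; proj₂)
open import Data.Empty using (⊥-elim)
open import Function using (id)
open import Relation.Nullary using (yes; no; does)
open import Relation.Nullary.Decidable using (dec-true; dec-false)
open import Relation.Binary.PropositionalEquality

lookup-injective : ∀ {A : Set} {xs : List A} → Unique xs →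
                   ∀ i j → lookup xs i ≡ lookup xs j → i ≡ j
lookup-injective (_  ∷ _) zero    zero    _  = refl
lookup-injective (x∉ ∷ _) zero    (suc j) eq = ⊥-elim (All.lookup x∉ (∈-lookup j) eq)
lookup-injective (x∉ ∷ _) (suc i) zero    eq = ⊥-elim (All.lookup x∉ (∈-lookup i) (sym eq))
lookup-injective (_  ∷ u) (suc i) (suc j) eq = cong suc (lookup-injective u i j eq)

unique-length : ∀ {N} {xs : List (Fin N)} → Unique xs → length xs ≤ N
unique-length u = injective⇒≤ (lookup-injective u _ _)

adj-distinct : ∀ {N} (G : Graph N) {x y} → Adj G x y → x ≢ y
adj-distinct G {x} e refl = subst T (irrefl G x) e

module Walks {N : ℕ} {G : Graph N} where

  append : ∀ {x y z} → Walk G x y → Walk G y z → Walk G x z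
  append here       q = q
  append (step e p) q = step e (append p q)

  weight-append : ∀ g {x y z} (p : Walk G x y) (q : Walk G y z) →
                  weight g (append p q) ≡ weight g p + weight g q
  weight-append g here q = refl
  weight-append g (step {x} {y} _ p) q = begin
    g x y + weight g (append p q)      ≡⟨ cong (λ t → g x y + t) (weight-append g p q) ⟩
    g x y + (weight g p + weight g q)  ≡⟨ +-assoc (g x y) _ _ ⟨
    (g x y + weight g p) + weight g q  ∎
    where open ≡-Reasoning

  weight-linear : ∀ s g ι {x y} (p : Walk G x y) →
                  weight (λ a b → s * g a b + ι a b) p ≡ s * weight g p + weight ι p
  weight-linear s g ι here = solve 1 (λ s → con 0 := s :* con 0 :+ con 0) refl s
    where open +-*-Solver
  weight-linear s g ι (step {x} {y} _ p) = begin
    (s * g x y + ι x y) + weight (λ a b → s * g a b + ι a b) p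
      ≡⟨ cong (λ t → (s * g x y + ι x y) + t) (weight-linear s g ι p) ⟩
    (s * g x y + ι x y) + (s * weight g p + weight ι p)
      ≡⟨ solve 5 (λ s a i b j → (s :* a :+ i) :+ (s :* b :+ j)
                                := s :* (a :+ b) :+ (i :+ j)) refl s (g x y) (ι x y) _ _ ⟩
    s * (g x y + weight g p) + (ι x y + weight ι p)  ∎
    where open ≡-Reasoning
          open +-*-Solver

  weight≤len : ∀ g → (∀ a b → g a b ≤ 1) → ∀ {x y} (p : Walk G x y) → weight g p ≤ len p
  weight≤len g g≤1 here = z≤n
  weight≤len g g≤1 (step {x} {y} _ p) = +-mono-≤ (g≤1 x y) (weight≤len g g≤1 p)

  path-len< : ∀ {x y} (p : Walk G x y) → IsPath p → len p < N
  path-len< p p-path = subst (_≤ N) (len-verts p) (unique-length p-path)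
    where
      len-verts : ∀ {x y} (p : Walk G x y) → length (verts p) ≡ suc (len p)
      len-verts here       = refl
      len-verts (step _ p) = cong suc (len-verts p)

  suffix-from : ∀ {x y z} (p : Walk G y z) → x ∈ verts p →
                Σ (Walk G x z) λ s → (IsPath p → IsPath s) × (∀ g → weight g s ≤ weight g p)
  suffix-from p@here       (here refl) = p , id , λ g → ≤-refl
  suffix-from p@(step _ _) (here refl) = p , id , λ g → ≤-refl
  suffix-from (step {y} {y'} _ p) (there x∈p) with suffix-from p x∈p
  ... | s , s-path , s≤p =
    s , (λ { (_ ∷ p-path) → s-path p-path }) , λ g → ≤-trans (s≤p g) (m≤n+m _ (g y y'))

  to-path : ∀ {x y} (p : Walk G x y) →
            Σ (Walk G x y) λ q → IsPath q × (∀ g → weight g q ≤ weight g p)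
  to-path here = here , All.[] ∷ [] , λ g → z≤n
  to-path {x} (step {y = y} e p) with to-path p
  ... | q , q-path , q≤p with any? (x ≟_) (verts q)
  ...   | yes x∈q = let (s , s-path , s≤q) = suffix-from q x∈q in
                    s , s-path q-path , λ g → ≤-trans (s≤q g) (≤-trans (q≤p g) (m≤n+m _ (g x y)))
  ...   | no  x∉q = step e q , ¬Any⇒All¬ (verts q) x∉q ∷ q-path , λ g → +-monoʳ-≤ (g x y) (q≤p g)

open Walks

scaled-≤ : ∀ M {a i j} → a ≤ j → i ≤ M → suc M * a + i ≤ suc M * j + M
scaled-≤ M a≤j i≤M = +-mono-≤ (*-monoʳ-≤ (suc M) a≤j) i≤M

scaled-≤⁻¹ : ∀ M {a i j} → suc M * a + i ≤ suc M * j + M → a ≤ j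
scaled-≤⁻¹ M {a} {i} {j} le = s≤s⁻¹ (*-cancelˡ-< (suc M) a (suc j) Na<N[1+j])
  where
    open ≤-Reasoning
    Na<N[1+j] : suc M * a < suc M * suc j
    Na<N[1+j] = begin-strict
      suc M * a          ≤⟨ m≤m+n _ i ⟩
      suc M * a + i      ≤⟨ le ⟩
      suc M * j + M      <⟨ +-monoʳ-< (suc M * j) (n<1+n M) ⟩
      suc M * j + suc M  ≡⟨ +-comm (suc M * j) (suc M) ⟩
      suc M + suc M * j  ≡⟨ *-suc (suc M) j ⟨
      suc M * suc j      ∎

scaled-threshold : ℕ → ℤ → ℤ
scaled-threshold M (+ j)    = + (suc M * j + M)
scaled-threshold M -[1+ j ] = -[1+ j ]

Near : ∀ {m} → Tree m → (Fin m → Fin m → ℕ) → ℤ → Fin m → Fin m → Set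
Near T f k a b = ∃ λ d → Dist T f a b d × + d ≤ℤ k

module Refined {m M : ℕ} (T : Tree m) (T' : Tree (suc M)) (c : Fin (suc M) → Fin m)
  (contraction : Contraction T' T c) (f : Fin m → Fin m → ℕ) (f-weighting : EdgeWeighting T f)
  where

  fibre-walk : ∀ x y → c x ≡ c y → Σ (Walk (graph T') x y) λ w → AllOn (λ z → c z ≡ c x) w
  fibre-walk = proj₁ (proj₂ contraction)

  edge-projects : ∀ {x y} → c x ≢ c y → Adj (graph T') x y → Adj (graph T) (c x) (c y)
  edge-projects {x} {y} cx≢cy e = proj₂ (proj₂ (proj₂ contraction) _ _ cx≢cy) (x , y , refl , refl , e)

  edge-lifts : ∀ {a b} → Adj (graph T) a b → ∃ λ x → ∃ λ y → c x ≡ a × c y ≡ b × Adj (graph T') x y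
  edge-lifts {a} {b} e = proj₁ (proj₂ (proj₂ contraction) a b (adj-distinct (graph T) e)) e

  by-fibre : Fin (suc M) → Fin (suc M) → ℕ → ℕ → ℕ
  by-fibre x y s d = if does (c x ≟ c y) then s else d

  within : ∀ {x y s d} → c x ≡ c y → by-fibre x y s d ≡ s
  within {x} {y} same rewrite dec-true (c x ≟ c y) same = refl

  across : ∀ {x y s d} → c x ≢ c y → by-fibre x y s d ≡ d
  across {x} {y} diff rewrite dec-false (c x ≟ c y) diff = refl

  by-fibre-sym : ∀ x y {s d d'} → d ≡ d' → by-fibre x y s d ≡ by-fibre y x s d'
  by-fibre-sym x y d≡d' with c x ≟ c y
  ... | yes same = sym (within (sym same))
  ... | no  diff = trans d≡d' (sym (across (λ eq → diff (sym eq))))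

  h ι : Fin (suc M) → Fin (suc M) → ℕ
  h x y = by-fibre x y 0 (f (c x) (c y))
  ι x y = by-fibre x y 1 0

  f' : Fin (suc M) → Fin (suc M) → ℕ
  f' x y = suc M * h x y + ι x y

  f'-weighting : EdgeWeighting T' f'
  f'-weighting = f'-sym , f'-pos
    where
      f'-sym : ∀ x y → f' x y ≡ f' y x
      f'-sym x y = cong₂ (λ a i → suc M * a + i)
        (by-fibre-sym x y (proj₁ f-weighting (c x) (c y))) (by-fibre-sym x y refl)
      f'-pos : ∀ x y → Adj (graph T') x y → 1 ≤ f' x y
      f'-pos x y e with c x ≟ c y
      ... | yes _    = m≤n+m 1 (suc M * 0)
      ... | no  diff = ≤-trans (proj₂ f-weighting _ _ (edge-projects diff e))
                               (≤-trans (m≤m+n _ (M * f (c x) (c y))) (m≤m+n _ 0))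

  path-contracts≤M : ∀ {x y} (p : Walk (graph T') x y) → IsPath p → weight ι p ≤ M
  path-contracts≤M p p-path =
    ≤-trans (weight≤len ι ι≤1 p) (s≤s⁻¹ (path-len< p p-path))
    where ι≤1 : ∀ x y → ι x y ≤ 1
          ι≤1 x y with c x ≟ c y
          ... | yes _ = ≤-refl
          ... | no  _ = z≤n

  fibre-weight : ∀ {x y a} (w : Walk (graph T') x y) → AllOn (λ z → c z ≡ a) w → weight h w ≡ 0
  fibre-weight here _ = refl
  fibre-weight (step {x} {y} _ w) (cx≡a , in-fibre) =
    cong₂ _+_ (within (trans cx≡a (sym (onHead w in-fibre)))) (fibre-weight w in-fibre)
    where onHead : ∀ {P : Fin (suc M) → Set} {x y} (w : Walk (graph T') x y) → AllOn P w → P x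
          onHead here       px       = px
          onHead (step _ w) (px , _) = px

  project : ∀ {x y a b} (p : Walk (graph T') x y) → c x ≡ a → c y ≡ b →
            Σ (Walk (graph T) a b) λ q → weight f q ≡ weight h p
  project here refl refl = here , refl
  project (step {x} {y} e p) refl cy≡b with c x ≟ c y
  ... | yes same = project p (sym same) cy≡b
  ... | no  diff = let (q , q≡p) = project p refl cy≡b in
                   step (edge-projects diff e) q , cong (λ t → f (c x) (c y) + t) q≡p

  -- Lifting a walk of T between the fibres of x and y to a walk of T' from x
  -- to y, of h-weight the f-weight; possible because fibres are connected.
  lift : ∀ {a b x y} (q : Walk (graph T) a b) → c x ≡ a → c y ≡ b →
         Σ (Walk (graph T') x y) λ w → weight h w ≡ weight f q
  lift {x = x} {y} here cx≡a cy≡a =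
    let (w , in-fibre) = fibre-walk x y (trans cx≡a (sym cy≡a)) in w , fibre-weight w in-fibre
  lift {a} {x = x} (step {y = a₁} e q) cx≡a cy≡b with edge-lifts e
  ... | x₁ , y₁ , cx₁≡a , cy₁≡a₁ , e' with fibre-walk x x₁ (trans cx≡a (sym cx₁≡a)) | lift q cy₁≡a₁ cy≡b
  ... | w₀ , in-fibre | w₁ , w₁≡q = append w₀ (step e' w₁) , (begin
    weight h (append w₀ (step e' w₁))        ≡⟨ weight-append h w₀ (step e' w₁) ⟩
    weight h w₀ + (h x₁ y₁ + weight h w₁)    ≡⟨ cong₂ _+_ (fibre-weight w₀ in-fibre)
                                                  (cong₂ _+_ (across diff) w₁≡q) ⟩
    f (c x₁) (c y₁) + weight f q             ≡⟨ cong (λ b → f b (c y₁) + weight f q) cx₁≡a ⟩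
    f a (c y₁) + weight f q                  ≡⟨ cong (λ b → f a b + weight f q) cy₁≡a₁ ⟩
    f a a₁ + weight f q                      ∎)
    where
      open ≡-Reasoning
      diff : c x₁ ≢ c y₁
      diff eq = adj-distinct (graph T) e (trans (sym cx₁≡a) (trans eq cy₁≡a₁))

  near-lifts : ∀ k {a b x y} → c x ≡ a → c y ≡ b →
               Near T f k a b → Near T' f' (scaled-threshold M k) x y
  near-lifts -[1+ _ ] _ _ (_ , _ , ())
  near-lifts (+ j) cx≡a cy≡b (_ , (q , _ , refl) , +≤+ q≤j) =
    let (w , w≡q)          = lift q cx≡a cy≡b
        (p , p-path , p≤w) = to-path w
    in weight f' p , (p , p-path , refl) , +≤+ (subst (_≤ suc M * j + M)
         (sym (weight-linear (suc M) h ι p))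
         (scaled-≤ M (≤-trans (p≤w h) (≤-trans (≤-reflexive w≡q) q≤j)) (path-contracts≤M p p-path)))

  near-projects : ∀ k {a b x y} → c x ≡ a → c y ≡ b →
                  Near T' f' (scaled-threshold M k) x y → Near T f k a b
  near-projects -[1+ _ ] _ _ (_ , _ , ())
  near-projects (+ j) cx≡a cy≡b (_ , (p , p-path , refl) , +≤+ p≤j') =
    let (q , q≡p)             = project p cx≡a cy≡b
        (q' , q'-path , q'≤q) = to-path q
        p≤j = scaled-≤⁻¹ M (subst (_≤ suc M * j + M) (weight-linear (suc M) h ι p) p≤j')
    in weight f q' , (q' , q'-path , refl) , +≤+ (≤-trans (q'≤q f) (≤-trans (≤-reflexive q≡p) p≤j))

-- T' is nonempty, so it has M + 1 vertices; the leaf root of T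
-- transfers along the contraction.
lemma2 : ∀ {n m m' : ℕ} (G : Graph n) → LeafPower G →
         (T : Tree m) (ℓ : Fin n → Fin m) → UnweightedLeafRoot G T ℓ →
         (T' : Tree m') (ℓ' : Fin n → Fin m') → Refinement T ℓ T' ℓ' →
         UnweightedLeafRoot G T' ℓ'
lemma2 {m' = zero} _ _ _ _ _ T' _ _ with nonempty T'
... | ()
lemma2 {m' = suc M} G _ T ℓ (f , k , _ , f-weighting , root) T' ℓ' (labelling' , c , contraction , c∘ℓ'≡ℓ) =
  f' , scaled-threshold M k , labelling' , f'-weighting , root'
  where
    open Refined T T' c contraction f f-weighting
    root' : ∀ u v → u ≢ v →
            (Adj G u v → Near T' f' (scaled-threshold M k) (ℓ' u) (ℓ' v)) ×
            (Near T' f' (scaled-threshold M k) (ℓ' u) (ℓ' v) → Adj G u v)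
    root' u v u≢v =
      (λ uv → near-lifts k (c∘ℓ'≡ℓ u) (c∘ℓ'≡ℓ v) (proj₁ (root u v u≢v) uv)) ,
      (λ near → proj₂ (root u v u≢v) (near-projects k (c∘ℓ'≡ℓ u) (c∘ℓ'≡ℓ v) near))
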